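{- Let $n$ be odd and let $G$ be a finite connected graph with a harmonic action of $D_n=\langle\sigma_1,\sigma_2\rangle$ as described in the context, with vertices labeled $z_i^j$ ($1\le j\le s$) and $x_i^j,y_i^j$ ($1\le j\le t$), $i\in\{1,\dots,n\}$. Let $\delta$ be a divisor of degree zero on $G$. Then $\delta\in\mathcal{P}=\mathcal{P}_1+\mathcal{P}_2+\mathcal{P}_3$ if and only if: (1) $\sum_{i=1}^n i\,(X_i+Y_i+Z_i)\equiv 0\pmod n$, where $X_i=\sum_{j=1}^t\delta(x_i^j)$, $Y_i=\sum_{j=1}^t\delta(y_i^j)$, $Z_i=\sum_{j=1}^s\delta(z_i^j)$; and (2) for each $j=1,\dots,t$, $\sum_{i=1}^n\delta(x_i^j)\equiv\sum_{i=1}^n\delta(y_i^j)\pmod n$.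
   Context: Graphs are finite, connected, may have multiple edges, no loops. A divisor on $G$ is a function from the vertex set to $\mathbb{Z}$; its degree is the sum of its values. Setting: $D_n$ is the dihedral group of order $2n$ generated by involutions $\sigma_1,\sigma_2$, acting on $G$ by automorphisms harmonically (no non-identity element fixes both endpoints of an edge), and every $D_n$-orbit of vertices has $n$ or $2n$ points. The vertices are labeled so that there are $s$ orbits of size $n$, $\{z_i^j: i=1,\dots,n\}$ for $j=1,\dots,s$, and $t$ orbits of size $2n$, $\{x_i^j,y_i^j\}$ for $j=1,\dots,t$, with (subscripts mod $n$) $\sigma_1(z_i^j)=z_{n+1-i}^j$, $\sigma_1(x_i^j)=y_{n+1-i}^j$, $\sigma_1(y_i^j)=x_{n+1-i}^j$, $\sigma_2(z_i^j)=z_{n+2-i}^j$, $\sigma_2(x_i^j)=y_{n+2-i}^j$, $\sigma_2(y_i^j)=x_{n+2-i}^j$. For a subgroup $\Gamma$ the quotient graph $G/\Gamma$ has vertices the $\Gamma$-orbits of vertices and edges the $\Gamma$-orbits of edges, quotient map $\phi$; the pullback of a divisor $\hat D$ on $G/\Gamma$ is $\phi^*(\hat D)(v)=|\mathrm{Stab}_\Gamma(v)|\,\hat D(\phi(v))$. Let $H_1=G/\langle\sigma_1\rangle$, $H_2=G/\langle\sigma_2\rangle$, $H_3=G/\langle\sigma_1\sigma_2\rangle$, let $\mathcal{P}_k$ be the set of divisors $\phi_k^*(\hat D)$ with $\hat D$ of degree zero on $H_k$, and $\mathcal{P}_1+\mathcal{P}_2+\mathcal{P}_3$ the set of sums $\delta_1+\delta_2+\delta_3$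 with $\delta_k\in\mathcal{P}_k$. -}

module Defs where

open import Data.Nat as ℕ using (ℕ; zero; suc; _<_; _≤ᵇ_)
open import Data.Fin as Fin using (Fin; toℕ; opposite)
open import Data.Fin.Properties as FinP using ()
open import Data.Integer as ℤ using (ℤ; +_; _-_)
open import Data.Bool using (Bool; true; false; _∧_; T?)
open import Data.List as List using (List; []; _∷_; allFin; concatMap; filter; length)
open import Data.List.Relation.Unary.All using (All)
open import Data.Product using (_×_; _,_; Σ; ∃)
open import Function using (id; _∘_)
open import Relation.Binary.PropositionalEquality using (_≡_; refl; cong; cong₂)
open import Relation.Nullary using (Dec; yes; no; ¬_)
open import Relation.Nullary.Decidable using (map′)
open import Data.Integer.Divisibility using (_∣_)

-- An index i : Fin n stands for the paper's subscript (toℕ i + 1) ∈ {1,…,n}.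
--   z j i  =  z_{i+1}^{j+1}   (j : Fin s)
--   x j i  =  x_{i+1}^{j+1}   (j : Fin t)
--   y j i  =  y_{i+1}^{j+1}   (j : Fin t)

data Vtx (s t n : ℕ) : Set where
  z : Fin s → Fin n → Vtx s t n
  x : Fin t → Fin n → Vtx s t n
  y : Fin t → Fin n → Vtx s t n

module _ {s t n : ℕ} where

  _≟V_ : (u v : Vtx s t n) → Dec (u ≡ v)
  z j i ≟V z j' i' = map′ (λ { (refl , refl) → refl }) (λ { refl → refl , refl })
                       (decPair (j Fin.≟ j') (i Fin.≟ i'))
    where
    decPair : ∀ {P Q : Set} → Dec P → Dec Q → Dec (P × Q)
    decPair (yes p) (yes q) = yes (p , q)
    decPair (no ¬p) _       = no λ { (p , _) → ¬p p }
    decPair (yes _) (no ¬q) = no λ { (_ , q) → ¬q q }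
  x j i ≟V x j' i' = map′ (λ { (refl , refl) → refl }) (λ { refl → refl , refl })
                       (decPair (j Fin.≟ j') (i Fin.≟ i'))
    where
    decPair : ∀ {P Q : Set} → Dec P → Dec Q → Dec (P × Q)
    decPair (yes p) (yes q) = yes (p , q)
    decPair (no ¬p) _       = no λ { (p , _) → ¬p p }
    decPair (yes _) (no ¬q) = no λ { (_ , q) → ¬q q }
  y j i ≟V y j' i' = map′ (λ { (refl , refl) → refl }) (λ { refl → refl , refl })
                       (decPair (j Fin.≟ j') (i Fin.≟ i'))
    where
    decPair : ∀ {P Q : Set} → Dec P → Dec Q → Dec (P × Q)
    decPair (yes p) (yes q) = yes (p , q)
    decPair (no ¬p) _       = no λ { (p , _) → ¬p p }
    decPair (yes _) (no ¬q) = no λ { (_ , q) → ¬q q }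
  z _ _ ≟V x _ _ = no λ ()
  z _ _ ≟V y _ _ = no λ ()
  x _ _ ≟V z _ _ = no λ ()
  x _ _ ≟V y _ _ = no λ ()
  y _ _ ≟V z _ _ = no λ ()
  y _ _ ≟V x _ _ = no λ ()

allV : (s t n : ℕ) → List (Vtx s t n)
allV s t n =
  concatMap (λ j → List.map (z j) (allFin n)) (allFin s) List.++
  concatMap (λ j → List.map (x j) (allFin n) List.++ List.map (y j) (allFin n)) (allFin t)

-- Injective numeric code of a vertex (used only to pick orbit representatives).
code : ∀ {s t n} → Vtx s t n → ℕ
code {s} {t} {n} (z j i) = toℕ j ℕ.* n ℕ.+ toℕ i
code {s} {t} {n} (x j i) = s ℕ.* n ℕ.+ 2 ℕ.* (toℕ j ℕ.* n ℕ.+ toℕ i)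
code {s} {t} {n} (y j i) = s ℕ.* n ℕ.+ 2 ℕ.* (toℕ j ℕ.* n ℕ.+ toℕ i) ℕ.+ 1

-- Index maps (mod n) on subscripts:  i ↦ n+1-i  and  i ↦ n+2-i.
-- With k = i - 1 ∈ Fin n: k ↦ n-1-k (= opposite) and k ↦ (n - k) mod n.

refl₁ : ∀ {n} → Fin n → Fin n
refl₁ = opposite

refl₂ : ∀ {n} → Fin n → Fin n
refl₂ {suc m} Fin.zero    = Fin.zero
refl₂ {suc m} (Fin.suc k) = Fin.suc (opposite k)

σ₁ : ∀ {s t n} → Vtx s t n → Vtx s t n
σ₁ (z j i) = z j (refl₁ i)
σ₁ (x j i) = y j (refl₁ i)
σ₁ (y j i) = x j (refl₁ i)

σ₂ : ∀ {s t n} → Vtx s t n → Vtx s t n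
σ₂ (z j i) = z j (refl₂ i)
σ₂ (x j i) = y j (refl₂ i)
σ₂ (y j i) = x j (refl₂ i)

ρ : ∀ {s t n} → Vtx s t n → Vtx s t n
ρ v = σ₁ (σ₂ v)

ρ^ : ∀ {s t n} → ℕ → Vtx s t n → Vtx s t n
ρ^ zero    = id
ρ^ (suc k) = ρ ∘ ρ^ k

-- The 2n elements of D_n: (k , false) ↦ ρ^k, (k , true) ↦ ρ^k σ₁.
-- The identity element is (zero , false).
actD : ∀ {s t n} → Fin n × Bool → Vtx s t n → Vtx s t n
actD (k , false) = ρ^ (toℕ k)
actD (k , true)  = ρ^ (toℕ k) ∘ σ₁

-- Graph structure: multigraph given by edge multiplicities A u v.

data Reach {V : Set} (A : V → V → ℕ) (u : V) : V → Set where
  here : Reach A u u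
  step : ∀ {v w} → Reach A u v → 0 < A v w → Reach A u w

record HarmonicDnGraph {s t n : ℕ} (A : Vtx s t n → Vtx s t n → ℕ) : Set where
  field
    symmetric : ∀ u v → A u v ≡ A v u
    loopless  : ∀ v → A v v ≡ 0
    connected : ∀ u v → Reach A u v
    σ₁-auto   : ∀ u v → A (σ₁ u) (σ₁ v) ≡ A u v
    σ₂-auto   : ∀ u v → A (σ₂ u) (σ₂ v) ≡ A u v
    harmonic  : ∀ u v → 0 < A u v → (k : Fin n) (b : Bool) → ¬ (toℕ k ≡ 0 × b ≡ false) →
                ¬ (actD (k , b) u ≡ u × actD (k , b) v ≡ v)

Divisor : (s t n : ℕ) → Set
Divisor s t n = Vtx s t n → ℤ

sumℤ : List ℤ → ℤ
sumℤ = List.foldr ℤ._+_ (+ 0)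

deg : ∀ {s t n} → Divisor s t n → ℤ
deg {s} {t} {n} D = sumℤ (List.map D (allV s t n))

-- Quotients by a subgroup Γ, given as the list of its (distinct) elements
-- acting on vertices.  A divisor on G/Γ is represented as a Γ-invariant
-- function on vertices (its value at v is the value at the orbit φ(v)).
-- The degree on G/Γ sums once per orbit, using as representative the
-- vertex with smallest code in its orbit.

Subgroup : (s t n : ℕ) → Set
Subgroup s t n = List (Vtx s t n → Vtx s t n)

Γ₁ Γ₂ Γ₃ : ∀ {s t n} → Subgroup s t n
Γ₁ = id ∷ σ₁ ∷ []
Γ₂ = id ∷ σ₂ ∷ []
Γ₃ {n = n} = List.map ρ^ (List.upTo n)

isRep : ∀ {s t n} → Subgroup s t n → Vtx s t n → Bool
isRep Γ v = List.foldr (λ g r → (code v ≤ᵇ code (g v)) ∧ r) true Γ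

QuotDivisor : ∀ {s t n} → Subgroup s t n → Set
QuotDivisor {s} {t} {n} Γ = Σ (Vtx s t n → ℤ) λ D̂ → All (λ g → ∀ v → D̂ (g v) ≡ D̂ v) Γ

degQ : ∀ {s t n} (Γ : Subgroup s t n) → QuotDivisor Γ → ℤ
degQ {s} {t} {n} Γ (D̂ , _) = sumℤ (List.map D̂ (filter (λ v → T? (isRep Γ v)) (allV s t n)))

stab : ∀ {s t n} → Subgroup s t n → Vtx s t n → ℕ
stab Γ v = length (filter (λ g → g v ≟V v) Γ)

pullback : ∀ {s t n} (Γ : Subgroup s t n) → QuotDivisor Γ → Divisor s t n
pullback Γ (D̂ , _) v = + stab Γ v ℤ.* D̂ v

InPk : ∀ {s t n} → Subgroup s t n → Divisor s t n → Set
InPk Γ δ = Σ (QuotDivisor Γ) λ D̂ → degQ Γ D̂ ≡ + 0 × (∀ v → δ v ≡ pullback Γ D̂ v)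

InP : ∀ {s t n} → Divisor s t n → Set
InP {s} {t} {n} δ =
  Σ (Divisor s t n) λ δ₁ → Σ (Divisor s t n) λ δ₂ → Σ (Divisor s t n) λ δ₃ →
    InPk Γ₁ δ₁ × InPk Γ₂ δ₂ × InPk Γ₃ δ₃ × (∀ v → δ v ≡ δ₁ v ℤ.+ δ₂ v ℤ.+ δ₃ v)

sumFin : (m : ℕ) → (Fin m → ℤ) → ℤ
sumFin m f = sumℤ (List.map f (allFin m))

Xs Ys Zs : ∀ {s t n} → Divisor s t n → Fin n → ℤ
Xs {s} {t} {n} δ i = sumFin t (λ j → δ (x j i))
Ys {s} {t} {n} δ i = sumFin t (λ j → δ (y j i))
Zs {s} {t} {n} δ i = sumFin s (λ j → δ (z j i))

Cond1 : ∀ {s t n} → Divisor s t n → Set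
Cond1 {s} {t} {n} δ =
  (+ n) ∣ sumFin n (λ i → + (suc (toℕ i)) ℤ.* (Xs δ i ℤ.+ Ys δ i ℤ.+ Zs δ i))

Cond2 : ∀ {s t n} → Divisor s t n → Set
Cond2 {s} {t} {n} δ =
  ∀ (j : Fin t) → (+ n) ∣ (sumFin n (λ i → δ (x j i)) - sumFin n (λ i → δ (y j i)))

-- Write symm₁ F = F + F ∘ σ₁ and symm₂ G = G + G ∘ σ₂.  The pullbacks from H₁, H₂ are exactly
-- the divisors symm₁ F, symm₂ G with deg F = deg G = 0, and those from H₃ are the divisors constant
-- along every row z^j, x^j, y^j whose row values add up to 0.  Conditions (1) and (2) say that two
-- kinds of linear functionals, the first moment Σ i δ(v) and the gaps Σ δ(x^j) - Σ δ(y^j), vanish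
-- mod n; they do so on each of these pieces, for the moment because n is odd, so n ∣ n(n+1)/2.
--
-- Conversely, inside a row δ minus its row sum placed at index 1 equals P - P ∘ ρ for the prefix
-- sums P, and P - P ∘ ρ = symm₁ P + symm₂ (- P ∘ σ₁) as ρ = σ₁σ₂; condition (2) lets the row sums
-- be absorbed as well, so δ = symm₁ F + symm₂ G + (row constants).  Then deg δ = 0 and condition (1)
-- force n ∣ deg F and n ∣ deg G, and moving multiples of the indicator χ of one row, which has
-- degree n and row-constant symmetrizations, into the row constants makes all three degrees 0.

module Submission where

open import Defs
open import Data.Bool using (Bool; true; false; if_then_else_; T?; _∧_)
open import Data.Bool.Properties using (T-≡; ∧-identityʳ; ¬-not)
open import Data.Empty using (⊥-elim)
open import Data.Fin as Fin using (Fin; toℕ; opposite; inject₁; fromℕ)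
open import Data.Fin.Permutation using (permutation)
open import Data.Fin.Properties
  using (toℕ-inject₁; toℕ-fromℕ; opposite-involutive; opposite-prop; toℕ<n; toℕ-injective)
open import Data.Integer using (ℤ; +_; _+_; _*_; -_; _-_)
open import Data.Integer.Divisibility.Signed as ∣ˢ
  using (∣-refl; ∣m∣n⇒∣m-n; ∣n⇒∣m*n; ∣m⇒∣m*n; ∣m∣n⇒∣m+n; divides) renaming (_∣_ to _∣ˢ_)
import Data.Integer.Properties as ℤP
open import Data.Integer.Tactic.RingSolver using (solve-∀)
open import Data.List as List using (List; []; _∷_; _++_; concatMap)
import Data.List.Properties as ListP
open import Data.List.Relation.Unary.All using (All; []; _∷_)
import Data.List.Relation.Unary.All.Properties as AllP
open import Data.Nat as ℕ using (ℕ; zero; suc; _%_)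
open import Data.Nat.DivMod using (m≡m%n+[m/n]*n)
import Data.Nat.Properties as ℕP
open import Data.Product using (Σ; ∃; _×_; _,_; proj₁; proj₂)
open import Data.Sum using ([_,_]′; inj₁; inj₂)
open import Function using (_∘_; id)
open import Function.Bundles using (_⇔_; mk⇔; Equivalence)
open import Relation.Binary.PropositionalEquality
  using (_≡_; _≢_; refl; sym; trans; cong; cong₂; subst; _≗_; module ≡-Reasoning)
open import Relation.Nullary using (Dec; yes; no; contradiction)
open import Relation.Nullary.Reflects using (ofʸ; ofⁿ)
open import Algebra.Properties.Semiring.Sum ℤP.+-*-semiring
  using (sum; sum-syntax; sum-cong-≗; ∑-distrib-+; ∑-comm; sum-permute; *-distribˡ-sum; *-distribʳ-sum;
         sum-init-last)

a+a≡2*a : ∀ (a : ℤ) → a + a ≡ + 2 * a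
a+a≡2*a = solve-∀

∑-const : ∀ n (c : ℤ) → ∑[ i < n ] c ≡ + n * c
∑-const zero    c = sym (ℤP.*-zeroˡ c)
∑-const (suc n) c = trans (cong (_+_ c) (∑-const n c)) (succ-* (+ n) c)
  where
  succ-* : ∀ (k c : ℤ) → c + k * c ≡ (+ 1 + k) * c
  succ-* = solve-∀

∑-involution : ∀ {n} (r : Fin n → Fin n) → (∀ i → r (r i) ≡ i) →
               ∀ (f : Fin n → ℤ) → ∑[ i < n ] f (r i) ≡ ∑[ i < n ] f i
∑-involution r r-inv f = sym (sum-permute f (permutation r r r-inv r-inv))

weight : ∀ {n} → Fin n → ℤ
weight i = + suc (toℕ i)

∑-weight*2 : ∀ n → (∑[ i < n ] weight i) * + 2 ≡ + n * (+ 1 + + n)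
∑-weight*2 zero    = refl
∑-weight*2 (suc n) = begin
  (∑[ i < suc n ] weight i) * + 2                     ≡⟨ cong (_* + 2) (sum-init-last (weight {suc n})) ⟩
  (∑[ i < n ] weight (inject₁ i) + weight (fromℕ n)) * + 2
    ≡⟨ cong₂ (λ a b → (a + + suc b) * + 2)
             (sum-cong-≗ {n} (λ i → cong (λ k → + suc k) (toℕ-inject₁ i))) (toℕ-fromℕ n) ⟩
  (∑[ i < n ] weight i + (+ 1 + + n)) * + 2           ≡⟨ ℤP.*-distribʳ-+ (+ 2) (∑[ i < n ] weight i) _ ⟩
  (∑[ i < n ] weight i) * + 2 + (+ 1 + + n) * + 2     ≡⟨ cong (_+ (+ 1 + + n) * + 2) (∑-weight*2 n) ⟩
  + n * (+ 1 + + n) + (+ 1 + + n) * + 2                ≡⟨ gauss (+ n) ⟩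
  (+ 1 + + n) * (+ 1 + (+ 1 + + n))                    ∎
  where
  open ≡-Reasoning
  gauss : ∀ (k : ℤ) → k * (+ 1 + k) + (+ 1 + k) * + 2 ≡ (+ 1 + k) * (+ 1 + (+ 1 + k))
  gauss = solve-∀

indicator₀ : ∀ {k} → Fin (suc k) → ℤ
indicator₀ Fin.zero    = + 1
indicator₀ (Fin.suc _) = + 0

∑-zero : ∀ k → ∑[ i < k ] (+ 0) ≡ + 0
∑-zero k = trans (∑-const k (+ 0)) (ℤP.*-zeroʳ (+ k))

∑-indicator₀ : ∀ k → ∑[ i < suc k ] indicator₀ {k} i ≡ + 1
∑-indicator₀ k = cong (_+_ (+ 1)) (∑-zero k)

∑-weight-odd : ∀ m → ∑[ i < suc (m ℕ.+ m) ] weight i ≡ + suc (m ℕ.+ m) * + suc m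
∑-weight-odd m = ℤP.*-cancelʳ-≡ _ _ (+ 2) (trans (∑-weight*2 (suc (m ℕ.+ m))) (regroup (+ m)))
  where
  regroup : ∀ (k : ℤ) → (+ 1 + k + k) * (+ 1 + (+ 1 + k + k)) ≡ (+ 1 + k + k) * (+ 1 + k) * + 2
  regroup = solve-∀

odd∣2*⇒∣ : ∀ m {a} → + suc (m ℕ.+ m) ∣ˢ + 2 * a → + suc (m ℕ.+ m) ∣ˢ a
odd∣2*⇒∣ m {a} n∣2a = subst (+ suc (m ℕ.+ m) ∣ˢ_) (sym (halve (+ m) a))
  (∣m∣n⇒∣m-n (∣n⇒∣m*n (+ 1 + + m) n∣2a) (∣m⇒∣m*n a ∣-refl))
  where
  halve : ∀ (k a : ℤ) → a ≡ (+ 1 + k) * (+ 2 * a) - (+ 1 + k + k) * a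
  halve = solve-∀

sumOver : ∀ {A : Set} → (A → ℤ) → List A → ℤ
sumOver f xs = sumℤ (List.map f xs)

sumOver-++ : ∀ {A : Set} (f : A → ℤ) xs ys → sumOver f (xs ++ ys) ≡ sumOver f xs + sumOver f ys
sumOver-++ f []       ys = sym (ℤP.+-identityˡ _)
sumOver-++ f (a ∷ xs) ys = trans (cong (_+_ (f a)) (sumOver-++ f xs ys)) (sym (ℤP.+-assoc (f a) _ _))

sumOver-concatMap : ∀ {A B : Set} (f : B → ℤ) (g : A → List B) xs →
                    sumOver f (concatMap g xs) ≡ sumOver (sumOver f ∘ g) xs
sumOver-concatMap f g []       = refl
sumOver-concatMap f g (a ∷ xs) =
  trans (sumOver-++ f (g a) (concatMap g xs)) (cong (_+_ (sumOver f (g a))) (sumOver-concatMap f g xs))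

sumOver-map : ∀ {A B : Set} (f : B → ℤ) (g : A → B) xs → sumOver f (List.map g xs) ≡ sumOver (f ∘ g) xs
sumOver-map f g []       = refl
sumOver-map f g (a ∷ xs) = cong (_+_ (f (g a))) (sumOver-map f g xs)

sumOver-tabulate : ∀ {A : Set} n (g : Fin n → A) (f : A → ℤ) →
                   sumOver f (List.tabulate g) ≡ ∑[ i < n ] f (g i)
sumOver-tabulate zero    g f = refl
sumOver-tabulate (suc n) g f = cong (_+_ (f (g Fin.zero))) (sumOver-tabulate n (g ∘ Fin.suc) f)

sumOver-cong : ∀ {A : Set} {f g : A → ℤ} → f ≗ g → ∀ xs → sumOver f xs ≡ sumOver g xs
sumOver-cong f≗g []       = refl
sumOver-cong f≗g (a ∷ xs) = cong₂ _+_ (f≗g a) (sumOver-cong f≗g xs)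

sumOver-+ : ∀ {A : Set} (f g : A → ℤ) xs →
            sumOver (λ a → f a + g a) xs ≡ sumOver f xs + sumOver g xs
sumOver-+ f g []       = refl
sumOver-+ f g (a ∷ xs) = trans (cong (_+_ (f a + g a)) (sumOver-+ f g xs)) (interchange (f a) (g a) _ _)
  where
  interchange : ∀ (a b c d : ℤ) → (a + b) + (c + d) ≡ (a + c) + (b + d)
  interchange = solve-∀

sumOver-* : ∀ {A : Set} (c : ℤ) (f : A → ℤ) xs → sumOver (λ a → c * f a) xs ≡ c * sumOver f xs
sumOver-* c f []       = sym (ℤP.*-zeroʳ c)
sumOver-* c f (a ∷ xs) = trans (cong (_+_ (c * f a)) (sumOver-* c f xs)) (sym (ℤP.*-distribˡ-+ c (f a) _))

sumFin≡∑ : ∀ n (f : Fin n → ℤ) → sumFin n f ≡ ∑[ i < n ] f i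
sumFin≡∑ n f = sumOver-tabulate n id f

sumOver-filter : ∀ {A : Set} (b : A → Bool) (f : A → ℤ) xs →
                 sumOver f (List.filter (λ a → T? (b a)) xs) ≡ sumOver (λ a → if b a then f a else + 0) xs
sumOver-filter b f []       = refl
sumOver-filter b f (a ∷ xs) with b a
... | true  = cong (_+_ (f a)) (sumOver-filter b f xs)
... | false = trans (sumOver-filter b f xs) (sym (ℤP.+-identityˡ _))

refl₂-involutive : ∀ {n} (i : Fin n) → refl₂ (refl₂ i) ≡ i
refl₂-involutive {suc _} Fin.zero    = refl
refl₂-involutive {suc _} (Fin.suc k) = cong Fin.suc (opposite-involutive k)

predᶜ : ∀ {N} → Fin (suc N) → Fin (suc N)
predᶜ {N} Fin.zero    = fromℕ N
predᶜ     (Fin.suc k) = inject₁ k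

predᶜ^ : ∀ {N} → ℕ → Fin (suc N) → Fin (suc N)
predᶜ^ zero    = id
predᶜ^ (suc k) = predᶜ ∘ predᶜ^ k

predᶜ^-+ : ∀ {N} a b (i : Fin (suc N)) → predᶜ^ (a ℕ.+ b) i ≡ predᶜ^ a (predᶜ^ b i)
predᶜ^-+ zero    b i = refl
predᶜ^-+ (suc a) b i = cong predᶜ (predᶜ^-+ a b i)

toℕ-predᶜ^ : ∀ {N} l (i : Fin (suc N)) → l ℕ.≤ toℕ i → toℕ (predᶜ^ l i) ℕ.+ l ≡ toℕ i
toℕ-predᶜ^ zero    i _   = ℕP.+-identityʳ (toℕ i)
toℕ-predᶜ^ (suc l) i l<i = one-more (predᶜ^ l i) (toℕ-predᶜ^ l i (ℕP.<⇒≤ l<i))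
  where
  one-more : ∀ p → toℕ p ℕ.+ l ≡ toℕ i → toℕ (predᶜ p) ℕ.+ suc l ≡ toℕ i
  one-more Fin.zero    eq = contradiction eq (ℕP.<⇒≢ l<i)
  one-more (Fin.suc k) eq = trans (cong (ℕ._+ suc l) (toℕ-inject₁ k)) (trans (ℕP.+-suc (toℕ k) l) eq)

predᶜ^-toℕ : ∀ {N} (i : Fin (suc N)) → predᶜ^ (toℕ i) i ≡ Fin.zero
predᶜ^-toℕ i = toℕ-injective (ℕP.+-cancelʳ-≡ (toℕ i) _ 0 (toℕ-predᶜ^ (toℕ i) i ℕP.≤-refl))

predᶜ^-no-fixed-point : ∀ {N} l (i : Fin (suc N)) → 0 ℕ.< l → l ℕ.≤ N → predᶜ^ l i ≢ i
predᶜ^-no-fixed-point {N} l i 0<l l≤N fixed with ℕP.≤-<-connex l (toℕ i)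
... | inj₁ l≤i = ℕP.<⇒≢ 0<l (sym (ℕP.+-cancelˡ-≡ (toℕ i) l 0
        (trans (trans (cong (λ u → toℕ u ℕ.+ l) (sym fixed)) (toℕ-predᶜ^ l i l≤i))
               (sym (ℕP.+-identityʳ (toℕ i))))))
-- Otherwise l = (i + 1) + p: the first i + 1 steps reach N, the remaining p ≤ N steps reach N ∸ p.
... | inj₂ i<l with ℕP.m≤n⇒∃[o]m+o≡n i<l
...   | p , i+1+p≡l = ℕP.<⇒≱ (ℕP.n<1+n N) (ℕP.≤-trans (ℕP.≤-reflexive (sym l≡1+N)) l≤N)
  where
  wrapped : predᶜ^ (suc (toℕ i)) i ≡ fromℕ N
  wrapped = cong predᶜ (predᶜ^-toℕ i)
  p≤N : p ℕ.≤ N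
  p≤N = ℕP.≤-trans (ℕP.m≤n+m p (suc (toℕ i))) (ℕP.≤-trans (ℕP.≤-reflexive i+1+p≡l) l≤N)
  i+p≡N : toℕ i ℕ.+ p ≡ N
  i+p≡N = begin
    toℕ i ℕ.+ p                                   ≡⟨ cong (λ u → toℕ u ℕ.+ p) (sym fixed) ⟩
    toℕ (predᶜ^ l i) ℕ.+ p
      ≡⟨ cong (λ u → toℕ u ℕ.+ p) (trans (cong (λ k → predᶜ^ k i) (sym (trans (ℕP.+-comm p _) i+1+p≡l)))
                                        (predᶜ^-+ p (suc (toℕ i)) i)) ⟩
    toℕ (predᶜ^ p (predᶜ^ (suc (toℕ i)) i)) ℕ.+ p ≡⟨ cong (λ u → toℕ (predᶜ^ p u) ℕ.+ p) wrapped ⟩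
    toℕ (predᶜ^ p (fromℕ N)) ℕ.+ p
      ≡⟨ toℕ-predᶜ^ p (fromℕ N) (ℕP.≤-trans p≤N (ℕP.≤-reflexive (sym (toℕ-fromℕ N)))) ⟩
    toℕ (fromℕ N)                                 ≡⟨ toℕ-fromℕ N ⟩
    N ∎
    where open ≡-Reasoning
  l≡1+N : l ≡ suc N
  l≡1+N = trans (sym i+1+p≡l) (cong suc i+p≡N)

opposite-refl₂ : ∀ {N} (i : Fin (suc N)) → opposite (refl₂ i) ≡ predᶜ i
opposite-refl₂ Fin.zero    = refl
opposite-refl₂ (Fin.suc k) = cong inject₁ (opposite-involutive k)

weight-opposite : ∀ {n} (i : Fin n) → weight i + weight (opposite i) ≡ + 1 + + n
weight-opposite {n} i = cong +_ (trans (ℕP.+-suc (suc (toℕ i)) (toℕ (opposite i)))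
  (cong suc (trans (cong (suc (toℕ i) ℕ.+_) (opposite-prop i)) (ℕP.m+[n∸m]≡n (toℕ<n i)))))

nonzero : ∀ {n} → Fin n → ℤ
nonzero Fin.zero    = + 0
nonzero (Fin.suc _) = + 1

weight-refl₂ : ∀ {N} (i : Fin (suc N)) → weight i + weight (refl₂ i) ≡ + 2 + + suc N * nonzero i
weight-refl₂ {N} Fin.zero    = sym (trans (cong (_+_ (+ 2)) (ℤP.*-zeroʳ (+ suc N))) (ℤP.+-identityʳ (+ 2)))
weight-refl₂ {N} (Fin.suc k) = begin
  (+ 1 + weight k) + (+ 1 + weight (opposite k)) ≡⟨ regroup (weight k) (weight (opposite k)) ⟩
  + 2 + (weight k + weight (opposite k))         ≡⟨ cong (_+_ (+ 2)) (weight-opposite k) ⟩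
  + 2 + + suc N                                  ≡⟨ cong (_+_ (+ 2)) (sym (ℤP.*-identityʳ (+ suc N))) ⟩
  + 2 + + suc N * + 1 ∎
  where
  open ≡-Reasoning
  regroup : ∀ (a b : ℤ) → (+ 1 + a) + (+ 1 + b) ≡ + 2 + (a + b)
  regroup = solve-∀

prefix : ∀ {k} → (Fin k → ℤ) → Fin k → ℤ
prefix f Fin.zero    = f Fin.zero
prefix f (Fin.suc i) = f Fin.zero + prefix (f ∘ Fin.suc) i

prefix-suc : ∀ {k} (f : Fin (suc k) → ℤ) (i : Fin k) → prefix f (Fin.suc i) ≡ prefix f (inject₁ i) + f (Fin.suc i)
prefix-suc f Fin.zero    = refl
prefix-suc f (Fin.suc i) = trans (cong (_+_ (f Fin.zero)) (prefix-suc (f ∘ Fin.suc) i)) (sym (ℤP.+-assoc (f Fin.zero) _ _))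

prefix-last : ∀ k (f : Fin (suc k) → ℤ) → prefix f (fromℕ k) ≡ sum f
prefix-last zero    f = sym (ℤP.+-identityʳ (f Fin.zero))
prefix-last (suc k) f = cong (_+_ (f Fin.zero)) (prefix-last k (f ∘ Fin.suc))

sumAtZero : ∀ {k} → (Fin k → ℤ) → Fin k → ℤ
sumAtZero f Fin.zero    = sum f
sumAtZero f (Fin.suc _) = + 0

prefix-telescope : ∀ {N} (f : Fin (suc N) → ℤ) i →
                   f i - sumAtZero f i ≡ prefix f i - prefix f (opposite (refl₂ i))
prefix-telescope {N} f Fin.zero    = cong (λ a → f Fin.zero - a) (sym (prefix-last N f))
prefix-telescope     f (Fin.suc k) = begin
  f (Fin.suc k) - + 0                           ≡⟨ shift (prefix f (inject₁ k)) (f (Fin.suc k)) ⟩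
  (prefix f (inject₁ k) + f (Fin.suc k)) - prefix f (inject₁ k)
    ≡⟨ cong₂ (λ a k′ → a - prefix f (inject₁ k′)) (sym (prefix-suc f k)) (sym (opposite-involutive k)) ⟩
  prefix f (Fin.suc k) - prefix f (inject₁ (opposite (opposite k))) ∎
  where
  open ≡-Reasoning
  shift : ∀ (p a : ℤ) → a - + 0 ≡ (p + a) - p
  shift = solve-∀

module _ {s t n : ℕ} where

  index : Vtx s t n → Fin n
  index (z _ i) = i
  index (x _ i) = i
  index (y _ i) = i

  deg-rows : ∀ (f : Vtx s t n → ℤ) →
    deg f ≡ ∑[ j < s ] ∑[ i < n ] f (z j i) + ∑[ j < t ] (∑[ i < n ] f (x j i) + ∑[ i < n ] f (y j i))
  deg-rows f = trans (sumOver-++ f (concatMap zRow (List.allFin s)) _)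
    (cong₂ _+_ (trans (sumOver-concatMap f zRow (List.allFin s))
                 (trans (sumOver-cong (rowSum z) (List.allFin s)) (sumFin≡∑ s _)))
               (trans (sumOver-concatMap f xyRows (List.allFin t))
                 (trans (sumOver-cong (λ j → trans (sumOver-++ f (xRow j) (yRow j)) (cong₂ _+_ (rowSum x j) (rowSum y j)))
                                      (List.allFin t))
                        (sumFin≡∑ t _))))
    where
    row : ∀ {k} → (Fin k → Fin n → Vtx s t n) → Fin k → List (Vtx s t n)
    row r j = List.map (r j) (List.allFin n)
    zRow = row z
    xRow = row x
    yRow = row y
    xyRows : Fin t → List (Vtx s t n)
    xyRows j = xRow j ++ yRow j
    rowSum : ∀ {k} (r : Fin k → Fin n → Vtx s t n) (j : Fin k) → sumOver f (row r j) ≡ ∑[ i < n ] f (r j i)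
    rowSum r j = trans (sumOver-map f (r j) (List.allFin n)) (sumFin≡∑ n (f ∘ r j))

  deg-cong : ∀ {f g : Vtx s t n → ℤ} → f ≗ g → deg f ≡ deg g
  deg-cong f≗g = sumOver-cong f≗g (allV s t n)

  deg-+ : ∀ (f g : Vtx s t n → ℤ) → deg (λ v → f v + g v) ≡ deg f + deg g
  deg-+ f g = sumOver-+ f g (allV s t n)

  deg-* : ∀ (c : ℤ) (f : Vtx s t n → ℤ) → deg (λ v → c * f v) ≡ c * deg f
  deg-* c f = sumOver-* c f (allV s t n)

  moment : Divisor s t n → ℤ
  moment δ = deg (λ v → weight (index v) * δ v)

  gap : Fin t → Divisor s t n → ℤ
  gap j δ = ∑[ i < n ] δ (x j i) - ∑[ i < n ] δ (y j i)

  moment-+ : ∀ (f g : Divisor s t n) → moment (λ v → f v + g v) ≡ moment f + moment g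
  moment-+ f g = trans (deg-cong (λ v → ℤP.*-distribˡ-+ (weight (index v)) (f v) (g v))) (deg-+ _ _)

  moment-cong : ∀ {f g : Divisor s t n} → f ≗ g → moment f ≡ moment g
  moment-cong f≗g = deg-cong (λ v → cong (weight (index v) *_) (f≗g v))

  gap-+ : ∀ j (f g : Divisor s t n) → gap j (λ v → f v + g v) ≡ gap j f + gap j g
  gap-+ j f g = trans (cong₂ _-_ (∑-distrib-+ (f ∘ x j) (g ∘ x j)) (∑-distrib-+ (f ∘ y j) (g ∘ y j)))
                      (interchange (sum (f ∘ x j)) (sum (g ∘ x j)) (sum (f ∘ y j)) (sum (g ∘ y j)))
    where
    interchange : ∀ (a b c d : ℤ) → (a + b) - (c + d) ≡ (a - c) + (b - d)
    interchange = solve-∀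

  gap-cong : ∀ j {f g : Divisor s t n} → f ≗ g → gap j f ≡ gap j g
  gap-cong j f≗g = cong₂ _-_ (sum-cong-≗ (f≗g ∘ x j)) (sum-cong-≗ (f≗g ∘ y j))

  moment≡Cond1-sum : ∀ (δ : Divisor s t n) →
    moment δ ≡ sumFin n (λ i → weight i * (Xs δ i + Ys δ i + Zs δ i))
  moment≡Cond1-sum δ = begin
    moment δ
      ≡⟨ deg-rows _ ⟩
    ∑[ j < s ] row z j + ∑[ j < t ] (row x j + row y j)
      ≡⟨ cong (_+_ (∑[ j < s ] row z j)) (∑-distrib-+ (row x) (row y)) ⟩
    ∑[ j < s ] row z j + (∑[ j < t ] row x j + ∑[ j < t ] row y j)
      ≡⟨ cong₂ _+_ (rows≡columns z) (cong₂ _+_ (rows≡columns x) (rows≡columns y)) ⟩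
    ∑[ i < n ] (weight i * Z i) + (∑[ i < n ] (weight i * X i) + ∑[ i < n ] (weight i * Y i))
      ≡⟨ trans (cong (_+_ (∑[ i < n ] (weight i * Z i))) (sym (∑-distrib-+ (λ i → weight i * X i) _)))
               (sym (∑-distrib-+ (λ i → weight i * Z i) _)) ⟩
    ∑[ i < n ] (weight i * Z i + (weight i * X i + weight i * Y i))
      ≡⟨ sum-cong-≗ (λ i → collect (weight i) (X i) (Y i) (Z i)) ⟩
    ∑[ i < n ] (weight i * (X i + Y i + Z i))
      ≡⟨ sym (trans (sumFin≡∑ n _) (sum-cong-≗ (λ i → cong (weight i *_)
                (cong₂ _+_ (cong₂ _+_ (sumFin≡∑ t (λ j → δ (x j i))) (sumFin≡∑ t (λ j → δ (y j i))))
                           (sumFin≡∑ s (λ j → δ (z j i))))))) ⟩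
    sumFin n (λ i → weight i * (Xs δ i + Ys δ i + Zs δ i)) ∎
    where
    open ≡-Reasoning
    row : ∀ {k} → (Fin k → Fin n → Vtx s t n) → Fin k → ℤ
    row r j = ∑[ i < n ] (weight i * δ (r j i))
    column : ∀ {k} → (Fin k → Fin n → Vtx s t n) → Fin n → ℤ
    column {k} r i = ∑[ j < k ] δ (r j i)
    X Y Z : Fin n → ℤ
    X = column x
    Y = column y
    Z = column z
    rows≡columns : ∀ {k} (r : Fin k → Fin n → Vtx s t n) →
      ∑[ j < k ] row r j ≡ ∑[ i < n ] (weight i * column r i)
    rows≡columns r = trans (∑-comm (λ j i → weight i * δ (r j i)))
                           (sum-cong-≗ (λ i → sym (*-distribˡ-sum (weight i) (λ j → δ (r j i)))))
    collect : ∀ (w a b c : ℤ) → w * c + (w * a + w * b) ≡ w * (a + b + c)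
    collect = solve-∀

  gap≡Cond2-difference : ∀ j (δ : Divisor s t n) →
    gap j δ ≡ sumFin n (λ i → δ (x j i)) - sumFin n (λ i → δ (y j i))
  gap≡Cond2-difference j δ = sym (cong₂ _-_ (sumFin≡∑ n _) (sumFin≡∑ n _))

rowTotal : ∀ {s t} → (Fin s → ℤ) → (Fin t → ℤ) → (Fin t → ℤ) → ℤ
rowTotal {s} {t} cz cx cy = ∑[ j < s ] cz j + ∑[ j < t ] (cx j + cy j)

module _ {s t n : ℕ} where

  rowConst : (Fin s → ℤ) → (Fin t → ℤ) → (Fin t → ℤ) → Divisor s t n
  rowConst cz cx cy (z j _) = cz j
  rowConst cz cx cy (x j _) = cx j
  rowConst cz cx cy (y j _) = cy j

  deg≡rowTotal : ∀ (f : Divisor s t n) {cz cx cy} →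
    (∀ j → sum (f ∘ z j) ≡ cz j) → (∀ j → sum (f ∘ x j) ≡ cx j) → (∀ j → sum (f ∘ y j) ≡ cy j) →
    deg f ≡ rowTotal cz cx cy
  deg≡rowTotal f hz hx hy =
    trans (deg-rows f) (cong₂ _+_ (sum-cong-≗ hz) (sum-cong-≗ (λ j → cong₂ _+_ (hx j) (hy j))))

  rowTotal-* : ∀ (k : ℤ) cz cx cy →
    rowTotal (λ j → k * cz j) (λ j → k * cx j) (λ j → k * cy j) ≡ k * rowTotal cz cx cy
  rowTotal-* k cz cx cy = begin
    ∑[ j < s ] (k * cz j) + ∑[ j < t ] (k * cx j + k * cy j)
      ≡⟨ cong (_+_ (∑[ j < s ] (k * cz j))) (sum-cong-≗ (λ j → sym (ℤP.*-distribˡ-+ k (cx j) (cy j)))) ⟩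
    ∑[ j < s ] (k * cz j) + ∑[ j < t ] (k * (cx j + cy j))
      ≡⟨ sym (cong₂ _+_ (*-distribˡ-sum k cz) (*-distribˡ-sum k (λ j → cx j + cy j))) ⟩
    k * ∑[ j < s ] cz j + k * ∑[ j < t ] (cx j + cy j)
      ≡⟨ sym (ℤP.*-distribˡ-+ k _ _) ⟩
    k * rowTotal cz cx cy ∎
    where open ≡-Reasoning

  deg-weighted-rowConst : ∀ (g : Fin n → ℤ) cz cx cy →
    deg (λ v → g (index v) * rowConst cz cx cy v) ≡ sum g * rowTotal cz cx cy
  deg-weighted-rowConst g cz cx cy = trans (deg≡rowTotal _ (along cz) (along cx) (along cy)) (rowTotal-* (sum g) cz cx cy)
    where
    along : ∀ {k} (c : Fin k → ℤ) j → ∑[ i < n ] (g i * c j) ≡ sum g * c j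
    along c j = sym (*-distribʳ-sum (c j) g)

  deg-rowConst : ∀ cz cx cy → deg (rowConst cz cx cy) ≡ + n * rowTotal cz cx cy
  deg-rowConst cz cx cy = trans (deg-cong (λ v → sym (ℤP.*-identityˡ (rowConst cz cx cy v))))
    (trans (deg-weighted-rowConst (λ _ → + 1) cz cx cy)
           (cong (_* rowTotal cz cx cy) (trans (∑-const n (+ 1)) (ℤP.*-identityʳ (+ n)))))

  moment-rowConst : ∀ cz cx cy → moment (rowConst cz cx cy) ≡ (∑[ i < n ] weight i) * rowTotal cz cx cy
  moment-rowConst = deg-weighted-rowConst weight

  gap-rowConst : ∀ j cz cx cy → gap j (rowConst cz cx cy) ≡ + n * (cx j - cy j)
  gap-rowConst j cz cx cy = trans (cong₂ _-_ (∑-const n (cx j)) (∑-const n (cy j))) (factor (+ n) (cx j) (cy j))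
    where
    factor : ∀ (k a b : ℤ) → k * a - k * b ≡ k * (a - b)
    factor = solve-∀

onReps : ∀ {s t n} → Subgroup s t n → (Vtx s t n → ℤ) → Vtx s t n → ℤ
onReps Γ D v = if isRep Γ v then D v else + 0

degQ≡deg-onReps : ∀ {s t n} (Γ : Subgroup s t n) (D̂ : QuotDivisor Γ) → degQ Γ D̂ ≡ deg (onReps Γ (proj₁ D̂))
degQ≡deg-onReps {s} {t} {n} Γ (D , _) = sumOver-filter (isRep Γ) D (allV s t n)

≤⇒≤ᵇ≡true : ∀ {a b} → a ℕ.≤ b → (a ℕ.≤ᵇ b) ≡ true
≤⇒≤ᵇ≡true a≤b = Equivalence.to T-≡ (ℕP.≤⇒≤ᵇ a≤b)

≤ᵇ-exactly-one : ∀ {a b} → a ≢ b → ∀ (d : ℤ) →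
                 (if a ℕ.≤ᵇ b then d else + 0) + (if b ℕ.≤ᵇ a then d else + 0) ≡ d
≤ᵇ-exactly-one {a} {b} a≢b d
  with a ℕ.≤ᵇ b | ℕP.≤ᵇ-reflects-≤ a b | b ℕ.≤ᵇ a | ℕP.≤ᵇ-reflects-≤ b a
... | true  | ofʸ a≤b | true  | ofʸ b≤a = contradiction (ℕP.≤-antisym a≤b b≤a) a≢b
... | true  | _       | false | _       = ℤP.+-identityʳ d
... | false | _       | true  | _       = ℤP.+-identityˡ d
... | false | ofⁿ a≰b | false | ofⁿ b≰a = ⊥-elim ([ a≰b , b≰a ]′ (ℕP.≤-total a b))

code-x≢code-y : ∀ {s t n} j j' (i i' : Fin n) → code (x {s} {t} j i) ≢ code (y {s} {t} j' i')
code-x≢code-y {s} {n = n} j j' i i' eq =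
  ℕP.even≢odd (toℕ j ℕ.* n ℕ.+ toℕ i) (toℕ j' ℕ.* n ℕ.+ toℕ i')
    (ℕP.+-cancelˡ-≡ (s ℕ.* n) _ _
      (trans eq (trans (ℕP.+-assoc (s ℕ.* n) _ 1) (cong (s ℕ.* n ℕ.+_) (ℕP.+-comm _ 1)))))

isRep≡true : ∀ {s t n} (Γ : Subgroup s t n) v → All (λ g → code v ℕ.≤ code (g v)) Γ → isRep Γ v ≡ true
isRep≡true []      v []           = refl
isRep≡true (g ∷ Γ) v (v≤gv ∷ v≤Γv) = cong₂ _∧_ (≤⇒≤ᵇ≡true v≤gv) (isRep≡true Γ v v≤Γv)

isRep-sound : ∀ {s t n} (Γ : Subgroup s t n) v → isRep Γ v ≡ true → All (λ g → code v ℕ.≤ code (g v)) Γ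
isRep-sound []      v _   = []
isRep-sound (g ∷ Γ) v rep with code v ℕ.≤ᵇ code (g v) | ℕP.≤ᵇ-reflects-≤ (code v) (code (g v))
... | true | ofʸ v≤gv = v≤gv ∷ isRep-sound Γ v rep

-- The quotients by σ₁ and σ₂

module Reflection {s t n : ℕ} (r : Fin n → Fin n) (r-involutive : ∀ i → r (r i) ≡ i)
  (σ : Vtx s t n → Vtx s t n)
  (σ-z : ∀ j i → σ (z j i) ≡ z j (r i))
  (σ-x : ∀ j i → σ (x j i) ≡ y j (r i))
  (σ-y : ∀ j i → σ (y j i) ≡ x j (r i)) where

  σ-involutive : ∀ v → σ (σ v) ≡ v
  σ-involutive (z j i) = trans (cong σ (σ-z j i)) (trans (σ-z j (r i)) (cong (z j) (r-involutive i)))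
  σ-involutive (x j i) = trans (cong σ (σ-x j i)) (trans (σ-y j (r i)) (cong (x j) (r-involutive i)))
  σ-involutive (y j i) = trans (cong σ (σ-y j i)) (trans (σ-x j (r i)) (cong (y j) (r-involutive i)))

  index-σ : ∀ v → index (σ v) ≡ r (index v)
  index-σ (z j i) = cong index (σ-z j i)
  index-σ (x j i) = cong index (σ-x j i)
  index-σ (y j i) = cong index (σ-y j i)

  sum-reflected : ∀ {g : Fin n → ℤ} (h : Fin n → ℤ) → (∀ i → g i ≡ h (r i)) → sum g ≡ sum h
  sum-reflected h g≡h∘r = trans (sum-cong-≗ g≡h∘r) (∑-involution r r-involutive h)

  deg-∘σ : ∀ (f : Vtx s t n → ℤ) → deg (f ∘ σ) ≡ deg f
  deg-∘σ f = trans (deg-rows (f ∘ σ)) (trans (cong₂ _+_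
    (sum-cong-≗ (λ j → sum-reflected (f ∘ z j) (λ i → cong f (σ-z j i))))
    (sum-cong-≗ (λ j → trans (cong₂ _+_ (sum-reflected (f ∘ y j) (λ i → cong f (σ-x j i)))
                                          (sum-reflected (f ∘ x j) (λ i → cong f (σ-y j i))))
                               (ℤP.+-comm (sum (f ∘ y j)) (sum (f ∘ x j))))))
    (sym (deg-rows f)))

  code-σ : ∀ v → code (σ v) ≡ code v → σ v ≡ v
  code-σ (z j i) eq = trans (σ-z j i) (cong (z j) (toℕ-injective
    (ℕP.+-cancelˡ-≡ (toℕ j ℕ.* n) _ _ (trans (cong code (sym (σ-z j i))) eq))))
  code-σ (x j i) eq = contradiction (sym (trans (cong code (sym (σ-x j i))) eq)) (code-x≢code-y {s} j j i (r i))
  code-σ (y j i) eq = contradiction (trans (cong code (sym (σ-y j i))) eq) (code-x≢code-y {s} j j (r i) i)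

  symm : Divisor s t n → Divisor s t n
  symm F v = F v + F (σ v)

  deg-symm : ∀ F → deg (symm F) ≡ deg F + deg F
  deg-symm F = trans (deg-+ F (F ∘ σ)) (cong (_+_ (deg F)) (deg-∘σ F))

  moment-symm : ∀ F → moment (symm F) ≡ deg (λ v → (weight (index v) + weight (r (index v))) * F v)
  moment-symm F = begin
    moment (symm F)                                    ≡⟨ moment-+ F (F ∘ σ) ⟩
    moment F + moment (F ∘ σ)                          ≡⟨ cong (_+_ (moment F)) moment-∘σ ⟩
    moment F + deg (λ v → weight (r (index v)) * F v)
      ≡⟨ sym (deg-+ (λ v → weight (index v) * F v) (λ v → weight (r (index v)) * F v)) ⟩
    deg (λ v → weight (index v) * F v + weight (r (index v)) * F v)
      ≡⟨ deg-cong (λ v → sym (ℤP.*-distribʳ-+ (F v) (weight (index v)) (weight (r (index v))))) ⟩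
    deg (λ v → (weight (index v) + weight (r (index v))) * F v) ∎
    where
    open ≡-Reasoning
    moment-∘σ : moment (F ∘ σ) ≡ deg (λ v → weight (r (index v)) * F v)
    moment-∘σ = trans (deg-cong (λ v → cong (λ i → weight i * F (σ v))
                        (sym (trans (cong r (index-σ v)) (r-involutive (index v))))))
                      (deg-∘σ (λ v → weight (r (index v)) * F v))

  gap-symm : ∀ j F → gap j (symm F) ≡ + 0
  gap-symm j F = begin
    gap j (symm F)
      ≡⟨ cong₂ _-_ (∑-distrib-+ (F ∘ x j) (F ∘ σ ∘ x j)) (∑-distrib-+ (F ∘ y j) (F ∘ σ ∘ y j)) ⟩
    (sum (F ∘ x j) + sum (F ∘ σ ∘ x j)) - (sum (F ∘ y j) + sum (F ∘ σ ∘ y j))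
      ≡⟨ cong₂ (λ a b → (sum (F ∘ x j) + a) - (sum (F ∘ y j) + b))
               (sum-reflected (F ∘ y j) (λ i → cong F (σ-x j i))) (sum-reflected (F ∘ x j) (λ i → cong F (σ-y j i))) ⟩
    (sum (F ∘ x j) + sum (F ∘ y j)) - (sum (F ∘ y j) + sum (F ∘ x j))
      ≡⟨ cancel (sum (F ∘ x j)) (sum (F ∘ y j)) ⟩
    + 0 ∎
    where
    open ≡-Reasoning
    cancel : ∀ (a b : ℤ) → (a + b) - (b + a) ≡ + 0
    cancel = solve-∀

  Γ : Subgroup s t n
  Γ = id ∷ σ ∷ []

  isRep-Γ : ∀ v → isRep Γ v ≡ (code v ℕ.≤ᵇ code (σ v))
  isRep-Γ v = trans (cong (λ b → b ∧ ((code v ℕ.≤ᵇ code (σ v)) ∧ true))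
                          (≤⇒≤ᵇ≡true (ℕP.≤-refl {code v})))
                    (∧-identityʳ _)

  stab-fixed : ∀ v → σ v ≡ v → stab Γ v ≡ 2
  stab-fixed v σv≡v = cong List.length (trans (ListP.filter-accept (λ g → g v ≟V v) {id} refl)
                                              (cong (id ∷_) (ListP.filter-accept (λ g → g v ≟V v) {σ} σv≡v)))

  stab-moved : ∀ v → σ v ≢ v → stab Γ v ≡ 1
  stab-moved v σv≢v = cong List.length (trans (ListP.filter-accept (λ g → g v ≟V v) {id} refl)
                                              (cong (id ∷_) (ListP.filter-reject (λ g → g v ≟V v) {σ} σv≢v)))

  onReps-pair : ∀ (D : Vtx s t n → ℤ) → (∀ v → D (σ v) ≡ D v) →
                ∀ v → onReps Γ D v + onReps Γ D (σ v) ≡ + stab Γ v * D v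
  onReps-pair D D-inv v with σ v ≟V v
  ... | yes σv≡v = begin
    onReps Γ D v + onReps Γ D (σ v)  ≡⟨ cong (λ u → onReps Γ D v + onReps Γ D u) σv≡v ⟩
    onReps Γ D v + onReps Γ D v      ≡⟨ cong (λ a → a + a) (cong (if_then D v else + 0) rep) ⟩
    D v + D v                        ≡⟨ a+a≡2*a (D v) ⟩
    + 2 * D v                        ≡⟨ cong (λ k → + k * D v) (sym (stab-fixed v σv≡v)) ⟩
    + stab Γ v * D v ∎
    where
    open ≡-Reasoning
    rep : isRep Γ v ≡ true
    rep = trans (isRep-Γ v) (≤⇒≤ᵇ≡true (ℕP.≤-reflexive (cong code (sym σv≡v))))
  ... | no σv≢v = begin
    onReps Γ D v + onReps Γ D (σ v)
      ≡⟨ cong₂ _+_ (cong (if_then D v else + 0) (isRep-Γ v))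
                   (trans (cong (if_then D (σ v) else + 0) (isRep-Γ (σ v)))
                          (cong₂ (λ c d → if code (σ v) ℕ.≤ᵇ code c then d else + 0) (σ-involutive v) (D-inv v))) ⟩
    (if code v ℕ.≤ᵇ code (σ v) then D v else + 0) + (if code (σ v) ℕ.≤ᵇ code v then D v else + 0)
      ≡⟨ ≤ᵇ-exactly-one (λ eq → σv≢v (code-σ v (sym eq))) (D v) ⟩
    D v                              ≡⟨ sym (ℤP.*-identityˡ (D v)) ⟩
    + 1 * D v                        ≡⟨ cong (λ k → + k * D v) (sym (stab-moved v σv≢v)) ⟩
    + stab Γ v * D v ∎
    where open ≡-Reasoning

  fromQuotient : ∀ {δ} → InPk Γ δ → ∃ λ F → deg F ≡ + 0 × δ ≗ symm F
  fromQuotient (D̂@(D , _ ∷ D-inv ∷ []) , degQ≡0 , δ≗pullback) =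
    onReps Γ D , trans (sym (degQ≡deg-onReps Γ D̂)) degQ≡0 ,
    λ v → trans (δ≗pullback v) (sym (onReps-pair D D-inv v))

  pushforward : Divisor s t n → Vtx s t n → ℤ
  pushforward F v with σ v ≟V v
  ... | yes _ = F v
  ... | no  _ = symm F v

  pushforward-moved : ∀ F v → σ v ≢ v → pushforward F v ≡ symm F v
  pushforward-moved F v σv≢v with σ v ≟V v
  ... | yes σv≡v = contradiction σv≡v σv≢v
  ... | no _     = refl

  stab*pushforward : ∀ F v → + stab Γ v * pushforward F v ≡ symm F v
  stab*pushforward F v with σ v ≟V v
  ... | yes σv≡v = trans (cong (λ k → + k * F v) (stab-fixed v σv≡v))
                         (trans (sym (a+a≡2*a (F v))) (cong (λ u → F v + F u) (sym σv≡v)))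
  ... | no σv≢v = trans (cong (λ k → + k * symm F v) (stab-moved v σv≢v)) (ℤP.*-identityˡ (symm F v))

  pushforward-invariant : ∀ F v → pushforward F (σ v) ≡ pushforward F v
  pushforward-invariant F v = by-cases (σ v ≟V v)
    where
    by-cases : Dec (σ v ≡ v) → pushforward F (σ v) ≡ pushforward F v
    by-cases (yes σv≡v) = cong (pushforward F) σv≡v
    by-cases (no σv≢v)  = begin
      pushforward F (σ v)   ≡⟨ pushforward-moved F (σ v) σσv≢σv ⟩
      F (σ v) + F (σ (σ v)) ≡⟨ cong (λ u → F (σ v) + F u) (σ-involutive v) ⟩
      F (σ v) + F v         ≡⟨ ℤP.+-comm (F (σ v)) (F v) ⟩
      symm F v              ≡⟨ sym (pushforward-moved F v σv≢v) ⟩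
      pushforward F v       ∎
      where
      open ≡-Reasoning
      σσv≢σv : σ (σ v) ≢ σ v
      σσv≢σv σσv≡σv = σv≢v (trans (sym (σ-involutive (σ v))) (trans (cong σ σσv≡σv) (σ-involutive v)))

  toQuotient : ∀ F → deg F ≡ + 0 → InPk Γ (symm F)
  toQuotient F degF≡0 = D̂ , degQ≡0 , λ v → sym (stab*pushforward F v)
    where
    D = pushforward F
    D̂ : QuotDivisor Γ
    D̂ = D , (λ _ → refl) ∷ pushforward-invariant F ∷ []
    twice-degQ : + 2 * deg (onReps Γ D) ≡ + 2 * + 0
    twice-degQ = begin
      + 2 * deg (onReps Γ D)                        ≡⟨ sym (a+a≡2*a (deg (onReps Γ D))) ⟩
      deg (onReps Γ D) + deg (onReps Γ D)           ≡⟨ cong (_+_ (deg (onReps Γ D))) (sym (deg-∘σ (onReps Γ D))) ⟩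
      deg (onReps Γ D) + deg (onReps Γ D ∘ σ)       ≡⟨ sym (deg-+ (onReps Γ D) (onReps Γ D ∘ σ)) ⟩
      deg (symm (onReps Γ D))                       ≡⟨ deg-cong (onReps-pair D (pushforward-invariant F)) ⟩
      deg (λ v → + stab Γ v * D v)                  ≡⟨ deg-cong (stab*pushforward F) ⟩
      deg (symm F)                                  ≡⟨ deg-symm F ⟩
      deg F + deg F                                 ≡⟨ cong₂ _+_ degF≡0 degF≡0 ⟩
      + 0 ∎
      where open ≡-Reasoning
    degQ≡0 : degQ Γ D̂ ≡ + 0
    degQ≡0 = trans (degQ≡deg-onReps Γ D̂) (ℤP.*-cancelˡ-≡ (+ 2) _ _ twice-degQ)

module Reflection₁ {s t n : ℕ} =
  Reflection {s} {t} {n} refl₁ opposite-involutive σ₁ (λ _ _ → refl) (λ _ _ → refl) (λ _ _ → refl)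
module Reflection₂ {s t n : ℕ} =
  Reflection {s} {t} {n} refl₂ refl₂-involutive σ₂ (λ _ _ → refl) (λ _ _ → refl) (λ _ _ → refl)

open Reflection₁ using () renaming (symm to symm₁)
open Reflection₂ using () renaming (symm to symm₂)

moment-symm₁ : ∀ {s t n} (F : Divisor s t n) → moment (symm₁ F) ≡ (+ 1 + + n) * deg F
moment-symm₁ {n = n} F = trans (Reflection₁.moment-symm F)
  (trans (deg-cong (λ v → cong (_* F v) (weight-opposite (index v)))) (deg-* (+ 1 + + n) F))

moment-symm₂ : ∀ {s t N} (G : Divisor s t (suc N)) →
  moment (symm₂ G) ≡ + 2 * deg G + + suc N * deg (λ v → nonzero (index v) * G v)
moment-symm₂ {N = N} G = begin
  moment (symm₂ G)
    ≡⟨ Reflection₂.moment-symm G ⟩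
  deg (λ v → (weight (index v) + weight (refl₂ (index v))) * G v)
    ≡⟨ deg-cong (λ v → trans (cong (_* G v) (weight-refl₂ (index v))) (spread (+ suc N) (nonzero (index v)) (G v))) ⟩
  deg (λ v → + 2 * G v + + suc N * (nonzero (index v) * G v))
    ≡⟨ trans (deg-+ (λ v → + 2 * G v) (λ v → + suc N * (nonzero (index v) * G v)))
             (cong₂ _+_ (deg-* (+ 2) G) (deg-* (+ suc N) (λ v → nonzero (index v) * G v))) ⟩
  + 2 * deg G + + suc N * deg (λ v → nonzero (index v) * G v) ∎
  where
  open ≡-Reasoning
  spread : ∀ (k e g : ℤ) → (+ 2 + k * e) * g ≡ + 2 * g + k * (e * g)
  spread = solve-∀

-- The quotient by ρ = σ₁σ₂

module Rotation {s t N : ℕ} where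

  atIndex : Vtx s t (suc N) → Fin (suc N) → Vtx s t (suc N)
  atIndex (z j _) i = z j i
  atIndex (x j _) i = x j i
  atIndex (y j _) i = y j i

  index-atIndex : ∀ v i → index (atIndex v i) ≡ i
  index-atIndex (z _ _) _ = refl
  index-atIndex (x _ _) _ = refl
  index-atIndex (y _ _) _ = refl

  atIndex-index : ∀ v → atIndex v (index v) ≡ v
  atIndex-index (z _ _) = refl
  atIndex-index (x _ _) = refl
  atIndex-index (y _ _) = refl

  atIndex-atIndex : ∀ v i i' → atIndex (atIndex v i) i' ≡ atIndex v i'
  atIndex-atIndex (z _ _) _ _ = refl
  atIndex-atIndex (x _ _) _ _ = refl
  atIndex-atIndex (y _ _) _ _ = refl

  ρ-atIndex : ∀ v → ρ v ≡ atIndex v (predᶜ (index v))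
  ρ-atIndex (z j i) = cong (z j) (opposite-refl₂ i)
  ρ-atIndex (x j i) = cong (x j) (opposite-refl₂ i)
  ρ-atIndex (y j i) = cong (y j) (opposite-refl₂ i)

  ρ^-atIndex : ∀ k v → ρ^ k v ≡ atIndex v (predᶜ^ k (index v))
  ρ^-atIndex zero    v = sym (atIndex-index v)
  ρ^-atIndex (suc k) v = begin
    ρ (ρ^ k v)                                              ≡⟨ cong ρ (ρ^-atIndex k v) ⟩
    ρ (atIndex v p)                                         ≡⟨ ρ-atIndex (atIndex v p) ⟩
    atIndex (atIndex v p) (predᶜ (index (atIndex v p)))     ≡⟨ atIndex-atIndex v p _ ⟩
    atIndex v (predᶜ (index (atIndex v p)))                 ≡⟨ cong (atIndex v ∘ predᶜ) (index-atIndex v p) ⟩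
    atIndex v (predᶜ p) ∎
    where
    open ≡-Reasoning
    p = predᶜ^ k (index v)

  index-ρ^ : ∀ k v → index (ρ^ k v) ≡ predᶜ^ k (index v)
  index-ρ^ k v = trans (cong index (ρ^-atIndex k v)) (index-atIndex v _)

  stab-Γ₃ : ∀ v → stab Γ₃ v ≡ 1
  stab-Γ₃ v = cong List.length (trans (ListP.filter-accept (λ g → g v ≟V v) {id} refl)
    (cong (id ∷_) (ListP.filter-none (λ g → g v ≟V v) (AllP.map⁺ (AllP.applyUpTo⁺₁ suc N moves)))))
    where
    moves : ∀ {k} → k ℕ.< N → ρ^ (suc k) v ≢ v
    moves {k} k<N ρv≡v = predᶜ^-no-fixed-point (suc k) (index v) (ℕ.s≤s ℕ.z≤n) k<N
      (trans (sym (index-ρ^ (suc k) v)) (cong index ρv≡v))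

  code-atIndex-zero-≤ : ∀ v i → code (atIndex v Fin.zero) ℕ.≤ code (atIndex v i)
  code-atIndex-zero-≤ (z j _) i = ℕP.+-monoʳ-≤ (toℕ j ℕ.* suc N) ℕ.z≤n
  code-atIndex-zero-≤ (x j _) i = ℕP.+-monoʳ-≤ (s ℕ.* suc N) (ℕP.*-monoʳ-≤ 2 (ℕP.+-monoʳ-≤ (toℕ j ℕ.* suc N) ℕ.z≤n))
  code-atIndex-zero-≤ (y j _) i =
    ℕP.+-monoˡ-≤ 1 (ℕP.+-monoʳ-≤ (s ℕ.* suc N) (ℕP.*-monoʳ-≤ 2 (ℕP.+-monoʳ-≤ (toℕ j ℕ.* suc N) ℕ.z≤n)))

  code-atIndex-zero-< : ∀ v k → code (atIndex v Fin.zero) ℕ.< code (atIndex v (Fin.suc k))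
  code-atIndex-zero-< (z j _) k = ℕP.+-monoʳ-< (toℕ j ℕ.* suc N) (ℕ.s≤s ℕ.z≤n)
  code-atIndex-zero-< (x j _) k =
    ℕP.+-monoʳ-< (s ℕ.* suc N) (ℕP.*-monoʳ-< 2 (ℕP.+-monoʳ-< (toℕ j ℕ.* suc N) (ℕ.s≤s ℕ.z≤n)))
  code-atIndex-zero-< (y j _) k =
    ℕP.+-monoˡ-< 1 (ℕP.+-monoʳ-< (s ℕ.* suc N) (ℕP.*-monoʳ-< 2 (ℕP.+-monoʳ-< (toℕ j ℕ.* suc N) (ℕ.s≤s ℕ.z≤n))))

  isRep-zero : ∀ v → isRep Γ₃ (atIndex v Fin.zero) ≡ true
  isRep-zero v = isRep≡true Γ₃ _ (AllP.map⁺ (AllP.applyUpTo⁺₂ id (suc N) (λ k →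
    ℕP.≤-trans (code-atIndex-zero-≤ v _)
               (ℕP.≤-reflexive (cong code (sym (trans (ρ^-atIndex k _) (atIndex-atIndex v Fin.zero _))))))))

  -- ρ^(k+1) carries index k+1 back to index 0, which has a smaller code.
  isRep-suc : ∀ v k → isRep Γ₃ (atIndex v (Fin.suc k)) ≡ false
  isRep-suc v k = ¬-not (λ rep → ℕP.<⇒≱ (code-atIndex-zero-< v k)
    (ℕP.≤-trans (AllP.applyUpTo⁻ id (suc N) (AllP.map⁻ (isRep-sound Γ₃ _ rep)) (toℕ<n (Fin.suc {N} k)))
                (ℕP.≤-reflexive (cong code back-to-zero))))
    where
    back-to-zero : ρ^ (suc (toℕ k)) (atIndex v (Fin.suc k)) ≡ atIndex v Fin.zero
    back-to-zero = trans (ρ^-atIndex (suc (toℕ k)) (atIndex v (Fin.suc k))) (trans (atIndex-atIndex v _ _)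
      (cong (atIndex v) (trans (cong (predᶜ^ (suc (toℕ k))) (index-atIndex v _)) (predᶜ^-toℕ (Fin.suc k)))))

  deg-onReps-Γ₃ : ∀ (D : Vtx s t (suc N) → ℤ) →
    deg (onReps Γ₃ D) ≡ rowTotal (λ j → D (z j Fin.zero)) (λ j → D (x j Fin.zero)) (λ j → D (y j Fin.zero))
  deg-onReps-Γ₃ D =
    deg≡rowTotal _ (λ j → rowSum (z j Fin.zero)) (λ j → rowSum (x j Fin.zero)) (λ j → rowSum (y j Fin.zero))
    where
    rowSum : ∀ v → ∑[ i < suc N ] onReps Γ₃ D (atIndex v i) ≡ D (atIndex v Fin.zero)
    rowSum v = trans (cong₂ _+_ (cong (if_then D (atIndex v Fin.zero) else + 0) (isRep-zero v))
                                (trans (sum-cong-≗ (λ k → cong (if_then D (atIndex v (Fin.suc k)) else + 0)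
                                                               (isRep-suc v k)))
                                       (∑-zero N)))
                     (ℤP.+-identityʳ _)

  rowConst-atIndex : ∀ cz cx cy v i → rowConst cz cx cy (atIndex v i) ≡ rowConst cz cx cy v
  rowConst-atIndex cz cx cy (z _ _) _ = refl
  rowConst-atIndex cz cx cy (x _ _) _ = refl
  rowConst-atIndex cz cx cy (y _ _) _ = refl

  pullback-Γ₃ : ∀ (D : Vtx s t (suc N) → ℤ) v → + stab Γ₃ v * D v ≡ D v
  pullback-Γ₃ D v = trans (cong (λ k → + k * D v) (stab-Γ₃ v)) (ℤP.*-identityˡ (D v))

  fromQuotient₃ : ∀ {δ} → InPk Γ₃ δ →
    Σ (Fin s → ℤ) λ cz → Σ (Fin t → ℤ) λ cx → Σ (Fin t → ℤ) λ cy →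
      rowTotal cz cx cy ≡ + 0 × δ ≗ rowConst cz cx cy
  fromQuotient₃ (D̂@(D , D-inv) , degQ≡0 , δ≗pullback) =
    cz , cx , cy , trans (sym (trans (degQ≡deg-onReps Γ₃ D̂) (deg-onReps-Γ₃ D))) degQ≡0 ,
    λ v → trans (δ≗pullback v) (trans (pullback-Γ₃ D v) (trans (D-at-zero v) (at-zero v)))
    where
    cz : Fin s → ℤ
    cz j = D (z j Fin.zero)
    cx cy : Fin t → ℤ
    cx j = D (x j Fin.zero)
    cy j = D (y j Fin.zero)
    D-at-zero : ∀ v → D v ≡ D (atIndex v Fin.zero)
    D-at-zero v = trans (sym (AllP.applyUpTo⁻ id (suc N) (AllP.map⁻ D-inv) (toℕ<n (index v)) v))
                        (cong D (trans (ρ^-atIndex (toℕ (index v)) v) (cong (atIndex v) (predᶜ^-toℕ (index v)))))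
    at-zero : ∀ v → D (atIndex v Fin.zero) ≡ rowConst cz cx cy v
    at-zero (z _ _) = refl
    at-zero (x _ _) = refl
    at-zero (y _ _) = refl

  toQuotient₃ : ∀ cz cx cy → rowTotal cz cx cy ≡ + 0 → InPk Γ₃ (rowConst cz cx cy)
  toQuotient₃ cz cx cy total≡0 = D̂ , trans (degQ≡deg-onReps Γ₃ D̂) (trans (deg-onReps-Γ₃ D) total≡0) ,
                                 λ v → sym (pullback-Γ₃ D v)
    where
    D = rowConst cz cx cy
    D̂ : QuotDivisor Γ₃
    D̂ = D , AllP.map⁺ (AllP.applyUpTo⁺₂ id (suc N)
                (λ k v → trans (cong D (ρ^-atIndex k v)) (rowConst-atIndex cz cx cy v _)))

-- Decompositions δ = symm₁ F + symm₂ G + rowConst c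

module _ {s t n : ℕ} where

  split : Divisor s t n → Divisor s t n → (Fin s → ℤ) → (Fin t → ℤ) → (Fin t → ℤ) → Divisor s t n
  split F G cz cx cy v = symm₁ F v + symm₂ G v + rowConst cz cx cy v

  record Decomposition (δ : Divisor s t n) : Set where
    constructor decomposition
    field
      F G    : Divisor s t n
      cz     : Fin s → ℤ
      cx cy  : Fin t → ℤ
      δ≗split : δ ≗ split F G cz cx cy

  deg-split : ∀ F G cz cx cy → deg (split F G cz cx cy) ≡ (deg F + deg F) + (deg G + deg G) + + n * rowTotal cz cx cy
  deg-split F G cz cx cy =
    trans (trans (deg-+ _ (rowConst cz cx cy)) (cong (_+ deg (rowConst cz cx cy)) (deg-+ (symm₁ F) (symm₂ G))))
          (cong₂ _+_ (cong₂ _+_ (Reflection₁.deg-symm F) (Reflection₂.deg-symm G)) (deg-rowConst cz cx cy))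

  gap-split : ∀ j F G cz cx cy → gap j (split F G cz cx cy) ≡ + n * (cx j - cy j)
  gap-split j F G cz cx cy = begin
    gap j (split F G cz cx cy)
      ≡⟨ trans (gap-+ j (λ v → symm₁ F v + symm₂ G v) K) (cong (_+ gap j K) (gap-+ j (symm₁ F) (symm₂ G))) ⟩
    gap j (symm₁ F) + gap j (symm₂ G) + gap j K
      ≡⟨ cong₂ _+_ (cong₂ _+_ (Reflection₁.gap-symm j F) (Reflection₂.gap-symm j G))
                   (gap-rowConst {n = n} j cz cx cy) ⟩
    + 0 + + 0 + + n * (cx j - cy j)
      ≡⟨ ℤP.+-identityˡ _ ⟩
    + n * (cx j - cy j) ∎
    where
    open ≡-Reasoning
    K : Divisor s t n
    K = rowConst cz cx cy

  rowConst-+ : ∀ (cz : Fin s → ℤ) (cx cy : Fin t → ℤ) cz' cx' cy' (v : Vtx s t n) →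
    rowConst (λ j → cz j + cz' j) (λ j → cx j + cx' j) (λ j → cy j + cy' j) v
      ≡ rowConst cz cx cy v + rowConst cz' cx' cy' v
  rowConst-+ _ _ _ _ _ _ (z _ _) = refl
  rowConst-+ _ _ _ _ _ _ (x _ _) = refl
  rowConst-+ _ _ _ _ _ _ (y _ _) = refl

  rowConst-neg : ∀ (cz : Fin s → ℤ) (cx cy : Fin t → ℤ) (v : Vtx s t n) →
    rowConst (λ j → - cz j) (λ j → - cx j) (λ j → - cy j) v ≡ - rowConst cz cx cy v
  rowConst-neg _ _ _ (z _ _) = refl
  rowConst-neg _ _ _ (x _ _) = refl
  rowConst-neg _ _ _ (y _ _) = refl

  rowConst-zero : ∀ v → rowConst {s} {t} {n} (λ _ → + 0) (λ _ → + 0) (λ _ → + 0) v ≡ + 0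
  rowConst-zero (z _ _) = refl
  rowConst-zero (x _ _) = refl
  rowConst-zero (y _ _) = refl

  decomposition-cong : ∀ {δ δ'} → δ ≗ δ' → Decomposition δ' → Decomposition δ
  decomposition-cong δ≗δ' (decomposition F G cz cx cy eq) = decomposition F G cz cx cy (λ v → trans (δ≗δ' v) (eq v))

  decomposition-+ : ∀ {δ δ'} → Decomposition δ → Decomposition δ' → Decomposition (λ v → δ v + δ' v)
  decomposition-+ (decomposition F G cz cx cy eq) (decomposition F' G' cz' cx' cy' eq') =
    decomposition (λ v → F v + F' v) (λ v → G v + G' v)
                  (λ j → cz j + cz' j) (λ j → cx j + cx' j) (λ j → cy j + cy' j)
      (λ v → trans (cong₂ _+_ (eq v) (eq' v))
        (trans (interchange (F v) (F (σ₁ v)) (G v) (G (σ₂ v)) (rowConst cz cx cy v)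
                            (F' v) (F' (σ₁ v)) (G' v) (G' (σ₂ v)) (rowConst cz' cx' cy' v))
               (cong (_+_ (symm₁ (λ u → F u + F' u) v + symm₂ (λ u → G u + G' u) v))
                     (sym (rowConst-+ cz cx cy cz' cx' cy' v)))))
    where
    interchange : ∀ (a b c d e a' b' c' d' e' : ℤ) →
      (a + b + (c + d) + e) + (a' + b' + (c' + d') + e') ≡ ((a + a') + (b + b') + ((c + c') + (d + d'))) + (e + e')
    interchange = solve-∀

  decomposition-neg : ∀ {δ} → Decomposition δ → Decomposition (λ v → - δ v)
  decomposition-neg (decomposition F G cz cx cy eq) =
    decomposition (λ v → - F v) (λ v → - G v) (λ j → - cz j) (λ j → - cx j) (λ j → - cy j)
      (λ v → trans (cong -_ (eq v))
        (trans (negate (F v) (F (σ₁ v)) (G v) (G (σ₂ v)) (rowConst cz cx cy v))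
               (cong (_+_ (symm₁ (λ u → - F u) v + symm₂ (λ u → - G u) v)) (sym (rowConst-neg cz cx cy v)))))
    where
    negate : ∀ (a b c d e : ℤ) → - (a + b + (c + d) + e) ≡ (- a + - b) + (- c + - d) + - e
    negate = solve-∀

  decomposition-symm₂ : ∀ G → Decomposition (symm₂ G)
  decomposition-symm₂ G = decomposition (λ _ → + 0) G (λ _ → + 0) (λ _ → + 0) (λ _ → + 0)
    (λ v → sym (trans (cong (_+_ (+ 0 + symm₂ G v)) (rowConst-zero v))
                      (trans (ℤP.+-identityʳ _) (ℤP.+-identityˡ (symm₂ G v)))))

  decomposition-rowConst : ∀ cz cx cy → Decomposition (rowConst cz cx cy)
  decomposition-rowConst cz cx cy = decomposition (λ _ → + 0) (λ _ → + 0) cz cx cy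
    (λ v → sym (ℤP.+-identityˡ (rowConst cz cx cy v)))

module _ {s t N : ℕ} where

  concentrate : Divisor s t (suc N) → Divisor s t (suc N)
  concentrate δ (z j i) = sumAtZero (δ ∘ z j) i
  concentrate δ (x j i) = sumAtZero (δ ∘ x j) i
  concentrate δ (y j i) = sumAtZero (δ ∘ y j) i

  prefixes : Divisor s t (suc N) → Divisor s t (suc N)
  prefixes δ (z j i) = prefix (δ ∘ z j) i
  prefixes δ (x j i) = prefix (δ ∘ x j) i
  prefixes δ (y j i) = prefix (δ ∘ y j) i

  telescope : ∀ δ v → δ v - concentrate δ v ≡ prefixes δ v - prefixes δ (ρ v)
  telescope δ (z j i) = prefix-telescope (δ ∘ z j) i
  telescope δ (x j i) = prefix-telescope (δ ∘ x j) i
  telescope δ (y j i) = prefix-telescope (δ ∘ y j) i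

  decomposition-unconcentrated : ∀ δ → Decomposition (λ v → δ v - concentrate δ v)
  decomposition-unconcentrated δ = decomposition P (λ v → - P (σ₁ v)) (λ _ → + 0) (λ _ → + 0) (λ _ → + 0)
    (λ v → trans (telescope δ v) (trans (regroup (P v) (P (ρ v)) (P (σ₁ v)))
                 (cong (_+_ (symm₁ P v + symm₂ (λ u → - P (σ₁ u)) v)) (sym (rowConst-zero v)))))
    where
    P = prefixes δ
    regroup : ∀ (a b c : ℤ) → a - b ≡ (a + c) + (- c + - b) + + 0
    regroup = solve-∀

  decomposition-concentrate-rowConst : ∀ cz cx cy → Decomposition (concentrate (rowConst cz cx cy))
  decomposition-concentrate-rowConst cz cx cy =
    decomposition-cong (λ v → sym (cancel (K v) (concentrate K v)))
      (decomposition-+ (decomposition-rowConst cz cx cy) (decomposition-neg (decomposition-unconcentrated K)))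
    where
    K = rowConst cz cx cy
    cancel : ∀ (a b : ℤ) → a + - (a - b) ≡ b
    cancel = solve-∀

  record BalancedDecomposition (δ : Divisor s t (suc N)) : Set where
    constructor balanced
    field
      parts       : Decomposition δ
      deg-F≡0     : deg (Decomposition.F parts) ≡ + 0
      deg-G≡0     : deg (Decomposition.G parts) ≡ + 0
      rowTotal≡0  : rowTotal (Decomposition.cz parts) (Decomposition.cx parts) (Decomposition.cy parts) ≡ + 0

  fromInP : ∀ {δ} → InP δ → BalancedDecomposition δ
  fromInP (δ₁ , δ₂ , δ₃ , δ₁∈𝒫₁ , δ₂∈𝒫₂ , δ₃∈𝒫₃ , δ≗sum)
    with Reflection₁.fromQuotient δ₁∈𝒫₁ | Reflection₂.fromQuotient δ₂∈𝒫₂ | Rotation.fromQuotient₃ δ₃∈𝒫₃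
  ... | F , deg-F≡0 , δ₁≗ | G , deg-G≡0 , δ₂≗ | cz , cx , cy , total≡0 , δ₃≗ =
    balanced (decomposition F G cz cx cy
               (λ v → trans (δ≗sum v) (cong₂ _+_ (cong₂ _+_ (δ₁≗ v) (δ₂≗ v)) (δ₃≗ v))))
             deg-F≡0 deg-G≡0 total≡0

  toInP : ∀ {δ} → BalancedDecomposition δ → InP δ
  toInP (balanced (decomposition F G cz cx cy δ≗split) deg-F≡0 deg-G≡0 total≡0) =
    symm₁ F , symm₂ G , rowConst cz cx cy ,
    Reflection₁.toQuotient F deg-F≡0 , Reflection₂.toQuotient G deg-G≡0 , Rotation.toQuotient₃ cz cx cy total≡0 ,
    δ≗split

module _ {s t m : ℕ} where

  private
    n : ℕ
    n = suc (m ℕ.+ m)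

  moment-split : ∀ (F G : Divisor s t n) cz cx cy →
    moment (split F G cz cx cy)
      ≡ deg F + + 2 * deg G + + n * (deg F + deg (λ v → nonzero (index v) * G v) + + suc m * rowTotal cz cx cy)
  moment-split F G cz cx cy = begin
    moment (split F G cz cx cy)
      ≡⟨ trans (moment-+ (λ v → symm₁ F v + symm₂ G v) K) (cong (_+ moment K) (moment-+ (symm₁ F) (symm₂ G))) ⟩
    moment (symm₁ F) + moment (symm₂ G) + moment K
      ≡⟨ cong₂ _+_ (cong₂ _+_ (moment-symm₁ F) (moment-symm₂ G))
                   (trans (moment-rowConst cz cx cy) (cong (_* rowTotal cz cx cy) (∑-weight-odd m))) ⟩
    (+ 1 + + n) * deg F + (+ 2 * deg G + + n * deg (λ v → nonzero (index v) * G v)) + + n * + suc m * rowTotal cz cx cy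
      ≡⟨ regroup (+ n) (deg F) (deg G) (deg (λ v → nonzero (index v) * G v)) (+ suc m) (rowTotal cz cx cy) ⟩
    deg F + + 2 * deg G + + n * (deg F + deg (λ v → nonzero (index v) * G v) + + suc m * rowTotal cz cx cy) ∎
    where
    open ≡-Reasoning
    K : Divisor s t n
    K = rowConst cz cx cy
    regroup : ∀ (k a b c h T : ℤ) → (+ 1 + k) * a + (+ 2 * b + k * c) + k * h * T ≡ a + + 2 * b + k * (a + c + h * T)
    regroup = solve-∀

  -- The row sums of z-rows are lifted with G₀ = (m+1)·S at index 0, which σ₂ fixes, giving 2(m+1)S = S + nS;
  -- the surplus nS, and the surplus n·q of an x-row over its y-row, are concentrated row constants.
  decomposition-concentrate : ∀ (δ : Divisor s t n) (q : Fin t → ℤ) → (∀ j → gap j δ ≡ q j * + n) →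
                              Decomposition (concentrate δ)
  decomposition-concentrate δ q gap≡qn =
    decomposition-cong concentrate≗
      (decomposition-+ (decomposition-symm₂ G₀) (decomposition-concentrate-rowConst Sz q (λ _ → + 0)))
    where
    Sz : Fin s → ℤ
    Sz j = - sum (δ ∘ z j)
    G₀ : Divisor s t n
    G₀ (z j Fin.zero)    = + suc m * sum (δ ∘ z j)
    G₀ (z j (Fin.suc _)) = + 0
    G₀ (x j Fin.zero)    = sum (δ ∘ y j)
    G₀ (x j (Fin.suc _)) = + 0
    G₀ (y j _)           = + 0
    lift-z : ∀ (k S : ℤ) → S ≡ ((+ 1 + k) * S + (+ 1 + k) * S) + (+ 1 + k + k) * - S
    lift-z = solve-∀
    lift-x : ∀ (Sx Sy q k : ℤ) → Sx - Sy ≡ q * k → Sx ≡ (Sy + + 0) + k * q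
    lift-x Sx Sy q k eq = trans (solve-x Sx Sy) (trans (cong (_+_ Sy) eq) (solve-qk Sy q k))
      where
      solve-x : ∀ (a b : ℤ) → a ≡ b + (a - b)
      solve-x = solve-∀
      solve-qk : ∀ (b q k : ℤ) → b + q * k ≡ (b + + 0) + k * q
      solve-qk = solve-∀
    concentrate≗ : ∀ v → concentrate δ v ≡ symm₂ G₀ v + concentrate (rowConst Sz q (λ _ → + 0)) v
    concentrate≗ (z j Fin.zero)    = trans (lift-z (+ m) (sum (δ ∘ z j)))
      (cong (_+_ (+ suc m * sum (δ ∘ z j) + + suc m * sum (δ ∘ z j))) (sym (∑-const n (Sz j))))
    concentrate≗ (z j (Fin.suc _)) = refl
    concentrate≗ (x j Fin.zero)    = trans (lift-x (sum (δ ∘ x j)) (sum (δ ∘ y j)) (q j) (+ n) (gap≡qn j))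
      (cong (_+_ (sum (δ ∘ y j) + + 0)) (sym (∑-const n (q j))))
    concentrate≗ (x j (Fin.suc _)) = refl
    concentrate≗ (y j Fin.zero)    = sym (trans (cong (_+_ (+ 0 + sum (δ ∘ y j))) (∑-zero n))
                                               (trans (ℤP.+-identityʳ _) (ℤP.+-identityˡ (sum (δ ∘ y j)))))
    concentrate≗ (y j (Fin.suc _)) = refl

  decompose : ∀ (δ : Divisor s t n) → (∀ j → + n ∣ˢ gap j δ) → Decomposition δ
  decompose δ n∣gap = decomposition-cong (λ v → sym (restore (δ v) (concentrate δ v)))
    (decomposition-+ (decomposition-unconcentrated δ)
                     (decomposition-concentrate δ (∣ˢ.quotient ∘ n∣gap) (∣ˢ._∣_.equality ∘ n∣gap)))
    where
    restore : ∀ (a b : ℤ) → (a - b) + b ≡ a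
    restore = solve-∀

  degrees-divisible : ∀ {δ} (D : Decomposition δ) → deg δ ≡ + 0 → + n ∣ˢ moment δ →
    + n ∣ˢ deg (Decomposition.F D) × + n ∣ˢ deg (Decomposition.G D)
  degrees-divisible {δ} (decomposition F G cz cx cy δ≗split) deg≡0 n∣moment = n∣A , odd∣2*⇒∣ m n∣2B
    where
    A B Y T : ℤ
    A = deg F
    B = deg G
    T = rowTotal cz cx cy
    Y = deg F + deg (λ v → nonzero (index v) * G v) + + suc m * T
    deg-δ : deg δ ≡ (A + A) + (B + B) + + n * T
    deg-δ = trans (deg-cong δ≗split) (deg-split F G cz cx cy)
    moment-δ : moment δ ≡ A + + 2 * B + + n * Y
    moment-δ = trans (moment-cong δ≗split) (moment-split F G cz cx cy)
    n∣deg : + n ∣ˢ deg δ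
    n∣deg = subst (+ n ∣ˢ_) (sym deg≡0) (divides (+ 0) refl)
    n∣n* : ∀ a → + n ∣ˢ + n * a
    n∣n* a = ∣m⇒∣m*n a ∣-refl
    A≡ : A ≡ deg δ - moment δ + + n * (Y - T)
    A≡ = sym (trans (cong₂ (λ d μ → d - μ + + n * (Y - T)) deg-δ moment-δ) (solve-A A B (+ n) T Y))
      where
      solve-A : ∀ (a b k T Y : ℤ) → ((a + a) + (b + b) + k * T) - (a + + 2 * b + k * Y) + k * (Y - T) ≡ a
      solve-A = solve-∀
    n∣A : + n ∣ˢ A
    n∣A = subst (+ n ∣ˢ_) (sym A≡) (∣m∣n⇒∣m+n (∣m∣n⇒∣m-n n∣deg n∣moment) (n∣n* (Y - T)))
    2B≡ : + 2 * B ≡ moment δ - A - + n * Y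
    2B≡ = sym (trans (cong (λ μ → μ - A - + n * Y) moment-δ) (solve-B A B (+ n) Y))
      where
      solve-B : ∀ (a b k Y : ℤ) → (a + + 2 * b + k * Y) - a - k * Y ≡ + 2 * b
      solve-B = solve-∀
    n∣2B : + n ∣ˢ + 2 * B
    n∣2B = subst (+ n ∣ˢ_) (sym 2B≡) (∣m∣n⇒∣m-n (∣m∣n⇒∣m-n n∣moment n∣A) (n∣n* Y))

  -- symm₁ χ and symm₂ χ are row constants, so α·χ and β·χ can be moved out of F and G.
  rebalance : ∀ {δ} (ez : Fin s → ℤ) (ex ey : Fin t → ℤ) (α β : ℤ) → Decomposition δ → Decomposition δ
  rebalance ez ex ey α β (decomposition F G cz cx cy δ≗split) =
    decomposition (λ v → F v + - α * χ v) (λ v → G v + - β * χ v) cz' cx' cy'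
      (λ v → trans (δ≗split v)
        (trans (move (F v) (F (σ₁ v)) (G v) (G (σ₂ v)) (rowConst cz cx cy v) α β (χ v) (χ (σ₁ v)) (χ (σ₂ v)))
               (cong (_+_ (symm₁ (λ u → F u + - α * χ u) v + symm₂ (λ u → G u + - β * χ u) v))
                     (sym (shifted v)))))
    where
    χ : Divisor s t n
    χ = rowConst ez ex ey
    cz' : Fin s → ℤ
    cz' j = cz j + α * (ez j + ez j) + β * (ez j + ez j)
    cx' cy' : Fin t → ℤ
    cx' j = cx j + α * (ex j + ey j) + β * (ex j + ey j)
    cy' j = cy j + α * (ey j + ex j) + β * (ey j + ex j)
    shifted : ∀ v → rowConst cz' cx' cy' v ≡ rowConst cz cx cy v + α * symm₁ χ v + β * symm₂ χ v
    shifted (z _ _) = refl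
    shifted (x _ _) = refl
    shifted (y _ _) = refl
    move : ∀ (f f₁ g g₂ r a b h h₁ h₂ : ℤ) →
      f + f₁ + (g + g₂) + r
        ≡ (f + - a * h + (f₁ + - a * h₁)) + (g + - b * h + (g₂ + - b * h₂)) + (r + a * (h + h₁) + b * (h + h₂))
    move = solve-∀

  balance : ∀ {δ} (ez : Fin s → ℤ) (ex ey : Fin t → ℤ) → rowTotal ez ex ey ≡ + 1 →
            Decomposition δ → deg δ ≡ + 0 → + n ∣ˢ moment δ → BalancedDecomposition δ
  balance {δ} ez ex ey unit D@(decomposition _ _ _ _ _ _) deg≡0 n∣moment =
    balanced D' deg-F'≡0 deg-G'≡0 (ℤP.*-cancelˡ-≡ (+ n) _ (+ 0) n*total≡0)
    where
    n∣A = proj₁ (degrees-divisible D deg≡0 n∣moment)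
    n∣B = proj₂ (degrees-divisible D deg≡0 n∣moment)
    α β : ℤ
    α = ∣ˢ.quotient n∣A
    β = ∣ˢ.quotient n∣B
    χ : Divisor s t n
    χ = rowConst ez ex ey
    deg-χ : deg χ ≡ + n
    deg-χ = trans (deg-rowConst ez ex ey) (trans (cong (+ n *_) unit) (ℤP.*-identityʳ (+ n)))
    cancel-χ : ∀ {f : Divisor s t n} a → deg f ≡ a * + n → deg (λ v → f v + - a * χ v) ≡ + 0
    cancel-χ {f} a deg-f = trans (deg-+ f (λ v → - a * χ v))
      (trans (cong₂ _+_ deg-f (trans (deg-* (- a) χ) (cong (- a *_) deg-χ))) (annihilate a (+ n)))
      where
      annihilate : ∀ (a k : ℤ) → a * k + - a * k ≡ + 0
      annihilate = solve-∀
    D' = rebalance ez ex ey α β D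
    open Decomposition D' using () renaming (F to F'; G to G'; cz to cz'; cx to cx'; cy to cy'; δ≗split to δ≗split')
    deg-F'≡0 : deg F' ≡ + 0
    deg-F'≡0 = cancel-χ α (∣ˢ._∣_.equality n∣A)
    deg-G'≡0 : deg G' ≡ + 0
    deg-G'≡0 = cancel-χ β (∣ˢ._∣_.equality n∣B)
    n*total≡0 : + n * rowTotal cz' cx' cy' ≡ + n * + 0
    n*total≡0 = begin
      + n * rowTotal cz' cx' cy'                             ≡⟨ sym (ℤP.+-identityˡ _) ⟩
      (+ 0 + + 0) + (+ 0 + + 0) + + n * rowTotal cz' cx' cy'
        ≡⟨ cong (λ a → a + + n * rowTotal cz' cx' cy')
                (sym (cong₂ (λ a b → (a + a) + (b + b)) deg-F'≡0 deg-G'≡0)) ⟩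
      (deg F' + deg F') + (deg G' + deg G') + + n * rowTotal cz' cx' cy'
        ≡⟨ sym (trans (deg-cong δ≗split') (deg-split F' G' cz' cx' cy')) ⟩
      deg δ                                                  ≡⟨ deg≡0 ⟩
      + 0                                                    ≡⟨ sym (ℤP.*-zeroʳ (+ n)) ⟩
      + n * + 0 ∎
      where open ≡-Reasoning

  balanced⇒conditions : ∀ {δ : Divisor s t n} → BalancedDecomposition δ → Cond1 δ × Cond2 δ
  balanced⇒conditions {δ} (balanced (decomposition F G cz cx cy δ≗split) deg-F≡0 deg-G≡0 _) =
    ∣ˢ.∣⇒∣ᵤ (divides Y (sym cond1)) , λ j → ∣ˢ.∣⇒∣ᵤ (divides (cx j - cy j) (sym (cond2 j)))
    where
    Y : ℤ
    Y = deg F + deg (λ v → nonzero (index v) * G v) + + suc m * rowTotal cz cx cy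
    cond1 : Y * + n ≡ sumFin n (λ i → weight i * (Xs δ i + Ys δ i + Zs δ i))
    cond1 = begin
      Y * + n
        ≡⟨ sym (trans (cong₂ (λ a b → a + + 2 * b + + n * Y) deg-F≡0 deg-G≡0) (only-n (+ n) Y)) ⟩
      deg F + + 2 * deg G + + n * Y         ≡⟨ sym (trans (moment-cong δ≗split) (moment-split F G cz cx cy)) ⟩
      moment δ                              ≡⟨ moment≡Cond1-sum δ ⟩
      sumFin n (λ i → weight i * (Xs δ i + Ys δ i + Zs δ i)) ∎
      where
      open ≡-Reasoning
      only-n : ∀ (k Y : ℤ) → + 0 + + 2 * + 0 + k * Y ≡ Y * k
      only-n = solve-∀
    cond2 : ∀ j → (cx j - cy j) * + n ≡ sumFin n (λ i → δ (x j i)) - sumFin n (λ i → δ (y j i))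
    cond2 j = trans (ℤP.*-comm (cx j - cy j) (+ n))
                (sym (trans (sym (gap≡Cond2-difference j δ)) (trans (gap-cong j δ≗split) (gap-split j F G cz cx cy))))

  unitRow×conditions⇒balanced : ∀ {δ : Divisor s t n} (ez : Fin s → ℤ) (ex ey : Fin t → ℤ) →
    rowTotal ez ex ey ≡ + 1 → deg δ ≡ + 0 → Cond1 δ × Cond2 δ → BalancedDecomposition δ
  unitRow×conditions⇒balanced {δ} ez ex ey unit deg≡0 (cond1 , cond2) =
    balance ez ex ey unit (decompose δ n∣gap) deg≡0
            (subst (+ n ∣ˢ_) (sym (moment≡Cond1-sum δ)) (∣ˢ.∣ᵤ⇒∣ cond1))
    where
    n∣gap : ∀ j → + n ∣ˢ gap j δ
    n∣gap j = subst (+ n ∣ˢ_) (sym (gap≡Cond2-difference j δ)) (∣ˢ.∣ᵤ⇒∣ (cond2 j))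

conditions⇒balanced : ∀ {m} s t {δ : Divisor s t (suc (m ℕ.+ m))} →
                       deg δ ≡ + 0 → Cond1 δ × Cond2 δ → BalancedDecomposition δ
conditions⇒balanced {m} (suc s) t =
  unitRow×conditions⇒balanced {m = m} (indicator₀ {s}) (λ _ → + 0) (λ _ → + 0)
    (cong₂ _+_ (∑-indicator₀ s) (∑-zero t))
conditions⇒balanced {m} zero (suc t) =
  unitRow×conditions⇒balanced {m = m} (λ ()) (indicator₀ {t}) (λ _ → + 0)
    (trans (ℤP.+-identityˡ (∑[ j < suc t ] (indicator₀ j + + 0)))
           (trans (sum-cong-≗ (λ j → ℤP.+-identityʳ (indicator₀ {t} j))) (∑-indicator₀ t)))
conditions⇒balanced zero zero _ _ =
  balanced (decomposition (λ _ → + 0) (λ _ → + 0) (λ ()) (λ ()) (λ ()) λ { (z () _) ; (x () _) ; (y () _) })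
           refl refl refl

odd⇒2m+1 : ∀ n → n % 2 ≡ 1 → Σ ℕ λ m → n ≡ suc (m ℕ.+ m)
odd⇒2m+1 n n%2≡1 = n ℕ./ 2 , trans (m≡m%n+[m/n]*n n 2)
  (cong₂ ℕ._+_ n%2≡1 (trans (ℕP.*-comm (n ℕ./ 2) 2) (cong (n ℕ./ 2 ℕ.+_) (ℕP.+-identityʳ (n ℕ./ 2)))))

InP⇔conditions : ∀ m {s t} (δ : Divisor s t (suc (m ℕ.+ m))) → deg δ ≡ + 0 → InP δ ⇔ (Cond1 δ × Cond2 δ)
InP⇔conditions m {s} {t} δ deg≡0 =
  mk⇔ (balanced⇒conditions {m = m} ∘ fromInP) (toInP ∘ conditions⇒balanced {m} s t deg≡0)

theorem3p3 : (n s t : ℕ) → n % 2 ≡ 1 →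
    (A : Vtx s t n → Vtx s t n → ℕ) → HarmonicDnGraph A →
    (δ : Divisor s t n) → deg δ ≡ + 0 →
    (InP δ ⇔ (Cond1 δ × Cond2 δ))
theorem3p3 n s t n-odd _ _ δ deg≡0 with odd⇒2m+1 n n-odd
... | m , refl = InP⇔conditions m δ deg≡0
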